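{- Let $B$ be a box (axis-parallel rectangle) of width $a$ and height $b$ in which a set of items is packed axis-parallel and non-overlapping, such that every item has width at least $\mu$, where $\mu>0$ is a constant. Let $P$ be the total profit of the items packed in $B$ and let $\epsilon_{\mathrm{box}}>0$ be a small constant. Then it is possible to pack all the items, except a set of items of total profit at most $\epsilon_{\mathrm{box}}\cdot P$ and a set of $O(1/\mu)$ items, into a box of width $a$ and height $(1-\epsilon_{\mathrm{box}})b$.
   Context: Items are axis-parallel rectangles with nonnegative profits. -}

module Defs where

open import Data.Nat.Base as ℕ using (ℕ; zero; suc)
open import Data.Integer.Base using (+_)
open import Data.Rational.Base using (ℚ; 0ℚ; _+_; _≤_; _/_)
open import Data.Fin.Base using (Fin; zero; suc)
open import Data.Fin.Subset using (Subset; _∉_)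
open import Data.Vec.Base using (lookup)
open import Data.Bool.Base using (if_then_else_)
open import Data.Product.Base using (_×_)
open import Data.Sum.Base using (_⊎_)
open import Relation.Binary.PropositionalEquality using (_≢_)

record Item : Set where
  constructor item
  field
    width  : ℚ
    height : ℚ
    profit : ℚ
open Item public

WellFormed : Item → Set
WellFormed it = (0ℚ ≤ width it) × (0ℚ ≤ height it) × (0ℚ ≤ profit it)

ℕtoℚ : ℕ → ℚ
ℕtoℚ k = + k / 1

sumFin : ∀ {n} → (Fin n → ℚ) → ℚ
sumFin {zero}  f = 0ℚ
sumFin {suc n} f = f zero + sumFin (λ i → f (suc i))

profitOf : ∀ {n} → (Fin n → Item) → Subset n → ℚ
profitOf I S = sumFin (λ i → if lookup S i then profit (I i) else 0ℚ)

totalProfit : ∀ {n} → (Fin n → Item) → ℚ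
totalProfit I = sumFin (λ i → profit (I i))

-- Position (x , y) of the bottom-left corner of each item.
Placement : ℕ → Set
Placement n = Fin n → ℚ × ℚ

open import Data.Product.Base using (proj₁; proj₂)

InBox : ∀ {n} → ℚ → ℚ → (Fin n → Item) → Placement n → Fin n → Set
InBox a b I pos i =
  (0ℚ ≤ proj₁ (pos i)) × (proj₁ (pos i) + width (I i) ≤ a) ×
  (0ℚ ≤ proj₂ (pos i)) × (proj₂ (pos i) + height (I i) ≤ b)

NonOverlap : ∀ {n} → (Fin n → Item) → Placement n → Fin n → Fin n → Set
NonOverlap I pos i j =
  (proj₁ (pos i) + width (I i) ≤ proj₁ (pos j)) ⊎
  (proj₁ (pos j) + width (I j) ≤ proj₁ (pos i)) ⊎
  (proj₂ (pos i) + height (I i) ≤ proj₂ (pos j)) ⊎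
  (proj₂ (pos j) + height (I j) ≤ proj₂ (pos i))

PacksAll : ∀ {n} → ℚ → ℚ → (Fin n → Item) → Placement n → Set
PacksAll a b I pos =
  (∀ i → InBox a b I pos i) × (∀ i j → i ≢ j → NonOverlap I pos i j)

PacksExcept : ∀ {n} → ℚ → ℚ → (Fin n → Item) → Subset n → Placement n → Set
PacksExcept a b I R pos =
  (∀ i → i ∉ R → InBox a b I pos i) ×
  (∀ i j → i ∉ R → j ∉ R → i ≢ j → NonOverlap I pos i j)

-- Write εbox = p/q and cut the box into q horizontal bands of height β = b/q. To remove band j
-- from a packing of height (m+1)β, discard the items whose bottom edge lies in the band and the
-- items crossing the line y = jβ, and move every item above the band down by β; this leaves a
-- packing of height mβ. Items crossing a common horizontal line have pairwise disjoint horizontal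
-- extents inside [0, a], so at most a/μ ≤ 1/μ of them are discarded. Every item has its bottom
-- edge in at most one band, so the cheapest band holds at most a 1/(m+1) share of the profit.
-- Removing p bands leaves height (q - p)β = (1 - εbox)b, discards at most p/μ crossing items,
-- and at most a p/q share of the profit.

module Submission where

open import Defs
open import Data.Nat.Base as ℕ using (ℕ; zero; suc)
import Data.Nat.Properties as ℕₚ
import Data.Nat.Coprimality as Coprimality
import Data.Integer.Base as ℤ
import Data.Integer.Properties as ℤₚ
open import Data.Rational.Base
  using ( ℚ; mkℚ; 0ℚ; 1ℚ; _+_; -_; _-_; _*_; 1/_; _≤_; _<_; *<*
        ; Positive; NonZero; positive; nonNegative)
open import Data.Rational.Properties
import Data.Rational.Unnormalised.Base as ℚᵘ
import Data.Rational.Unnormalised.Properties as ℚᵘₚ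
open import Data.Rational.Solver using (module +-*-Solver)
open +-*-Solver using (solve; _:+_; _:-_; _:*_; _:=_; con)
open import Data.Fin.Base using (Fin; zero; suc; toℕ)
open import Data.Fin.Properties using (toℕ-injective; toℕ≤pred[n]; suc-injective)
open import Data.Fin.Subset using (_∪_; ∣_∣; _∈_; _∉_)
open import Data.Fin.Subset.Properties using (x∈p∪q⁺)
open import Data.Vec.Base using (tabulate)
open import Data.Vec.Properties using (lookup∘tabulate; lookup⇒[]=)
open import Data.Bool.Base using (Bool; true; false; T; not; _∧_; _∨_; if_then_else_)
open import Data.Bool.Properties using (T-≡; T-not-≡; T-∧; T-∨; ∧-zeroʳ)
open import Data.Product.Base using (_×_; _,_; proj₁; proj₂; ∃-syntax; Σ-syntax)
open import Data.Sum.Base as Sum using (_⊎_; inj₁; inj₂)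
open import Data.Unit.Base using (tt)
open import Function.Base using (_∘_)
open import Function.Bundles using (Equivalence)
open import Relation.Nullary using (¬_; yes; no; contradiction)
open import Relation.Nullary.Decidable
  using (⌊_⌋; toSum; toWitness; fromWitness; toWitnessFalse; fromWitnessFalse)
open import Relation.Binary.PropositionalEquality

open Equivalence using (to; from)

p≤p+q : ∀ {p q} → 0ℚ ≤ q → p ≤ p + q
p≤p+q {p} {q} 0≤q = subst (_≤ p + q) (+-identityʳ p) (+-monoʳ-≤ p 0≤q)

p≤q⇒0≤q-p : ∀ {p q} → p ≤ q → 0ℚ ≤ q - p
p≤q⇒0≤q-p {p} {q} p≤q = subst (_≤ q - p) (+-inverseʳ p) (+-monoˡ-≤ (- p) p≤q)

<⇒≱ : ∀ {p q} → p < q → ¬ q ≤ p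
<⇒≱ p<q q≤p = <-irrefl refl (<-≤-trans p<q q≤p)

p+q≤r⇒p≤r-q : ∀ {p q r} → p + q ≤ r → p ≤ r - q
p+q≤r⇒p≤r-q {p} {q} {r} p+q≤r = begin
  p            ≡⟨ solve 2 (λ p q → p := (p :+ q) :- q) refl p q ⟩
  (p + q) - q  ≤⟨ +-monoˡ-≤ (- q) p+q≤r ⟩
  r - q        ∎
  where open ≤-Reasoning

p≤q+r⇒p-r≤q : ∀ {p q r} → p ≤ q + r → p - r ≤ q
p≤q+r⇒p-r≤q {p} {q} {r} p≤q+r = begin
  p - r        ≤⟨ +-monoˡ-≤ (- r) p≤q+r ⟩
  (q + r) - r  ≡⟨ solve 2 (λ q r → (q :+ r) :- r := q) refl q r ⟩
  q            ∎
  where open ≤-Reasoning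

p-r+q≡p+q-r : ∀ p q r → (p - r) + q ≡ (p + q) - r
p-r+q≡p+q-r = solve 3 (λ p q r → (p :- r) :+ q := (p :+ q) :- r) refl

*-monoˡ-≤′ : ∀ r {p q} → 0ℚ ≤ r → p ≤ q → r * p ≤ r * q
*-monoˡ-≤′ r 0≤r = *-monoˡ-≤-nonNeg r {{nonNegative 0≤r}}

ℕtoℚ≡mkℚ : ∀ k → ℕtoℚ k ≡ mkℚ (ℤ.+ k) 0 (Coprimality.sym (Coprimality.1-coprimeTo k))
ℕtoℚ≡mkℚ k = normalize-coprime _

ℕtoℚ-suc : ∀ k → ℕtoℚ (suc k) ≡ 1ℚ + ℕtoℚ k
ℕtoℚ-suc k = begin
  ℕtoℚ (suc k)
    ≡⟨ /-cong (cong (ℤ._+_ (ℤ.+ 1)) (sym (ℤₚ.*-identityʳ (ℤ.+ k)))) refl ⟩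
  1ℚ + mkℚ (ℤ.+ k) 0 (Coprimality.sym (Coprimality.1-coprimeTo k))
    ≡⟨ cong (1ℚ +_) (ℕtoℚ≡mkℚ k) ⟨
  1ℚ + ℕtoℚ k ∎
  where open ≡-Reasoning

ℕtoℚ-+ : ∀ m n → ℕtoℚ (m ℕ.+ n) ≡ ℕtoℚ m + ℕtoℚ n
ℕtoℚ-+ zero    n = sym (+-identityˡ (ℕtoℚ n))
ℕtoℚ-+ (suc m) n = begin
  ℕtoℚ (suc (m ℕ.+ n))      ≡⟨ ℕtoℚ-suc (m ℕ.+ n) ⟩
  1ℚ + ℕtoℚ (m ℕ.+ n)       ≡⟨ cong (1ℚ +_) (ℕtoℚ-+ m n) ⟩
  1ℚ + (ℕtoℚ m + ℕtoℚ n)    ≡⟨ +-assoc 1ℚ (ℕtoℚ m) (ℕtoℚ n) ⟨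
  (1ℚ + ℕtoℚ m) + ℕtoℚ n    ≡⟨ cong (_+ ℕtoℚ n) (ℕtoℚ-suc m) ⟨
  ℕtoℚ (suc m) + ℕtoℚ n     ∎
  where open ≡-Reasoning

ℕtoℚ-nonNeg : ∀ k → 0ℚ ≤ ℕtoℚ k
ℕtoℚ-nonNeg k = nonNegative⁻¹ (ℕtoℚ k) {{normalize-nonNeg k 1}}

ℕtoℚ-pos : ∀ k → 0ℚ < ℕtoℚ (suc k)
ℕtoℚ-pos k = positive⁻¹ (ℕtoℚ (suc k)) {{normalize-pos (suc k) 1}}

ℕtoℚ-mono : ∀ {m n} → m ℕ.≤ n → ℕtoℚ m ≤ ℕtoℚ n
ℕtoℚ-mono {m} m≤n with ℕₚ.m≤n⇒∃[o]m+o≡n m≤n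
... | o , refl = subst (ℕtoℚ m ≤_) (sym (ℕtoℚ-+ m o)) (p≤p+q (ℕtoℚ-nonNeg o))

ℕtoℚ-*-mkℚ : ∀ x d .(c : Coprimality.Coprime x (suc d)) → ℕtoℚ (suc d) * mkℚ (ℤ.+ x) d c ≡ ℕtoℚ x
ℕtoℚ-*-mkℚ x d c rewrite ℕtoℚ≡mkℚ x | ℕtoℚ≡mkℚ (suc d) =
  toℚᵘ-injective (ℚᵘₚ.≃-trans (toℚᵘ-homo-* q (mkℚ (ℤ.+ x) d c)) (ℚᵘ.*≡* (cross (ℤ.+ suc d) (ℤ.+ x))))
  where
  q : ℚ
  q = mkℚ (ℤ.+ suc d) 0 (Coprimality.sym (Coprimality.1-coprimeTo (suc d)))
  cross : ∀ D X → (D ℤ.* X) ℤ.* ℤ.+ 1 ≡ X ℤ.* (ℤ.+ 1 ℤ.* D)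
  cross D X = trans (ℤₚ.*-identityʳ (D ℤ.* X))
    (trans (ℤₚ.*-comm D X) (cong (X ℤ.*_) (sym (ℤₚ.*-identityˡ D))))

sumFin-cong : ∀ {n} {f g : Fin n → ℚ} → (∀ i → f i ≡ g i) → sumFin f ≡ sumFin g
sumFin-cong {zero}  f≡g = refl
sumFin-cong {suc n} f≡g = cong₂ _+_ (f≡g zero) (sumFin-cong (f≡g ∘ suc))

sumFin-mono : ∀ {n} {f g : Fin n → ℚ} → (∀ i → f i ≤ g i) → sumFin f ≤ sumFin g
sumFin-mono {zero}  f≤g = ≤-refl
sumFin-mono {suc n} f≤g = +-mono-≤ (f≤g zero) (sumFin-mono (f≤g ∘ suc))

sumFin-+ : ∀ {n} (f g : Fin n → ℚ) → sumFin (λ i → f i + g i) ≡ sumFin f + sumFin g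
sumFin-+ {zero}  f g = refl
sumFin-+ {suc n} f g = begin
  (f zero + g zero) + sumFin (λ i → f (suc i) + g (suc i))
    ≡⟨ cong ((f zero + g zero) +_) (sumFin-+ (f ∘ suc) (g ∘ suc)) ⟩
  (f zero + g zero) + (sumFin (f ∘ suc) + sumFin (g ∘ suc))
    ≡⟨ solve 4 (λ a b c d → (a :+ b) :+ (c :+ d) := (a :+ c) :+ (b :+ d)) refl
         (f zero) (g zero) (sumFin (f ∘ suc)) (sumFin (g ∘ suc)) ⟩
  (f zero + sumFin (f ∘ suc)) + (g zero + sumFin (g ∘ suc)) ∎
  where open ≡-Reasoning

sumFin-const : ∀ n c → sumFin {n} (λ _ → c) ≡ ℕtoℚ n * c
sumFin-const zero    c = sym (*-zeroˡ c)
sumFin-const (suc n) c = begin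
  c + sumFin {n} (λ _ → c)   ≡⟨ cong (c +_) (sumFin-const n c) ⟩
  c + ℕtoℚ n * c             ≡⟨ cong (_+ ℕtoℚ n * c) (*-identityˡ c) ⟨
  1ℚ * c + ℕtoℚ n * c        ≡⟨ *-distribʳ-+ c 1ℚ (ℕtoℚ n) ⟨
  (1ℚ + ℕtoℚ n) * c          ≡⟨ cong (_* c) (ℕtoℚ-suc n) ⟨
  ℕtoℚ (suc n) * c           ∎
  where open ≡-Reasoning

sumFin-zero : ∀ n → sumFin {n} (λ _ → 0ℚ) ≡ 0ℚ
sumFin-zero n = trans (sumFin-const n 0ℚ) (*-zeroʳ (ℕtoℚ n))

sumFin-comm : ∀ {m n} (g : Fin m → Fin n → ℚ) →
  sumFin (λ j → sumFin (λ i → g i j)) ≡ sumFin (λ i → sumFin (λ j → g i j))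
sumFin-comm {m} {zero}  g = sym (sumFin-zero m)
sumFin-comm {m} {suc n} g = begin
  sumFin (λ i → g i zero) + sumFin (λ j → sumFin (λ i → g i (suc j)))
    ≡⟨ cong (sumFin (λ i → g i zero) +_) (sumFin-comm (λ i j → g i (suc j))) ⟩
  sumFin (λ i → g i zero) + sumFin (λ i → sumFin (λ j → g i (suc j)))
    ≡⟨ sumFin-+ (λ i → g i zero) (λ i → sumFin (λ j → g i (suc j))) ⟨
  sumFin (λ i → sumFin (λ j → g i j)) ∎
  where open ≡-Reasoning

argmin : ∀ m (g : Fin (suc m) → ℚ) → ∃[ j ] (∀ i → g j ≤ g i)
argmin zero    g = zero , λ { zero → ≤-refl }
argmin (suc m) g with argmin m (g ∘ suc)
... | j , gj≤ with g zero ≤? g (suc j)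
...   | yes g0≤gj = zero , λ { zero → ≤-refl ; (suc i) → ≤-trans g0≤gj (gj≤ i) }
...   | no  g0≰gj = suc j , λ { zero → <⇒≤ (≰⇒> g0≰gj) ; (suc i) → gj≤ i }

below-average : ∀ m (g : Fin (suc m) → ℚ) → ∃[ j ] ℕtoℚ (suc m) * g j ≤ sumFin g
below-average m g with argmin m g
... | j , gj≤ = j , subst (_≤ sumFin g) (sumFin-const (suc m) (g j)) (sumFin-mono gj≤)

T-not⇒¬T : ∀ {b} → T (not b) → ¬ T b
T-not⇒¬T {false} _ ()

¬T⇒T-not : ∀ {b} → ¬ T b → T (not b)
¬T⇒T-not {true}  ¬b = ¬b tt
¬T⇒T-not {false} ¬b = tt

_⊆_ : ∀ {n} → (Fin n → Bool) → (Fin n → Bool) → Set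
S ⊆ S′ = ∀ i → T (S i) → T (S′ i)

select : Bool → ℚ → ℚ
select b x = if b then x else 0ℚ

sumOver : ∀ {n} → (Fin n → Bool) → (Fin n → ℚ) → ℚ
sumOver S f = sumFin (λ i → select (S i) (f i))

select-nonNeg : ∀ b {x} → 0ℚ ≤ x → 0ℚ ≤ select b x
select-nonNeg true  0≤x = 0≤x
select-nonNeg false 0≤x = ≤-refl

select-mono : ∀ b b′ {x} → 0ℚ ≤ x → (T b → T b′) → select b x ≤ select b′ x
select-mono true  true  0≤x b⇒b′ = ≤-refl
select-mono true  false 0≤x b⇒b′ = contradiction (b⇒b′ tt) λ ()
select-mono false b′    0≤x b⇒b′ = select-nonNeg b′ 0≤x

select-∨ : ∀ b b′ {x} → 0ℚ ≤ x → select (b ∨ b′) x ≤ select b x + select b′ x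
select-∨ true  b′ 0≤x = p≤p+q (select-nonNeg b′ 0≤x)
select-∨ false b′ {x} 0≤x = ≤-reflexive (sym (+-identityˡ (select b′ x)))

select-split : ∀ b c x → select b x ≡ select (b ∧ c) x + select (b ∧ not c) x
select-split true  true  x = sym (+-identityʳ x)
select-split true  false x = sym (+-identityˡ x)
select-split false c     x = sym (+-identityˡ 0ℚ)

select-≤ : ∀ b {x y} → (T b → x ≤ y) → select b x ≤ select b y
select-≤ true  x≤y = x≤y tt
select-≤ false x≤y = ≤-refl

sumOver-⊆ : ∀ {n} {S S′ : Fin n → Bool} {f} → (∀ i → 0ℚ ≤ f i) → S ⊆ S′ →
  sumOver S f ≤ sumOver S′ f
sumOver-⊆ {S = S} {S′} 0≤f S⊆S′ = sumFin-mono (λ i → select-mono (S i) (S′ i) (0≤f i) (S⊆S′ i))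

sumOver-mono : ∀ {n} (S : Fin n → Bool) {f g} → (∀ i → T (S i) → f i ≤ g i) →
  sumOver S f ≤ sumOver S g
sumOver-mono S f≤g = sumFin-mono (λ i → select-≤ (S i) (f≤g i))

sumOver-∨ : ∀ {n} (S S′ : Fin n → Bool) {f} → (∀ i → 0ℚ ≤ f i) →
  sumOver (λ i → S i ∨ S′ i) f ≤ sumOver S f + sumOver S′ f
sumOver-∨ S S′ {f} 0≤f = ≤-trans (sumFin-mono (λ i → select-∨ (S i) (S′ i) (0≤f i)))
  (≤-reflexive (sumFin-+ (λ i → select (S i) (f i)) (λ i → select (S′ i) (f i))))

sumOver-split : ∀ {n} (S P : Fin n → Bool) f →
  sumOver S f ≡ sumOver (λ i → S i ∧ P i) f + sumOver (λ i → S i ∧ not (P i)) f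
sumOver-split S P f = trans (sumFin-cong (λ i → select-split (S i) (P i) (f i)))
  (sumFin-+ (λ i → select (S i ∧ P i) (f i)) (λ i → select (S i ∧ not (P i)) (f i)))

sumOver-atMostOne : ∀ {n} (S : Fin n → Bool) {c} → 0ℚ ≤ c →
  (∀ i j → T (S i) → T (S j) → i ≡ j) → sumOver S (λ _ → c) ≤ c
sumOver-atMostOne {zero}  S 0≤c unique = 0≤c
sumOver-atMostOne {suc n} S {c} 0≤c unique with S zero in S₀
... | true  = ≤-trans (+-monoʳ-≤ c rest≤0) (≤-reflexive (+-identityʳ c))
  where
  others-unselected : (S ∘ suc) ⊆ (λ _ → false)
  others-unselected i Ssi = contradiction (unique zero (suc i) (subst T (sym S₀) tt) Ssi) λ ()
  rest≤0 : sumOver (S ∘ suc) (λ _ → c) ≤ 0ℚ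
  rest≤0 = ≤-trans (sumOver-⊆ (λ _ → 0≤c) others-unselected) (≤-reflexive (sumFin-zero n))
... | false = subst (_≤ c) (sym (+-identityˡ _))
  (sumOver-atMostOne (S ∘ suc) 0≤c (λ i j Ssi Ssj → suc-injective (unique (suc i) (suc j) Ssi Ssj)))

-- Disjoint intervals

Apart : ℚ → ℚ → ℚ → ℚ → Set
Apart x w x′ w′ = x + w ≤ x′ ⊎ x′ + w′ ≤ x

-- The interval at index 0 splits the other selected intervals into those on its left and those on
-- its right; each part is handled recursively inside its own gap.
disjoint-intervals-length : ∀ {n} (x w : Fin n → ℚ) (S : Fin n → Bool) {lo hi} → lo ≤ hi →
  (∀ i → T (S i) → lo ≤ x i × x i + w i ≤ hi) →
  (∀ i j → T (S i) → T (S j) → i ≢ j → Apart (x i) (w i) (x j) (w j)) →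
  sumOver S w ≤ hi - lo
disjoint-intervals-length {zero}  x w S lo≤hi inside apart = p≤q⇒0≤q-p lo≤hi
disjoint-intervals-length {suc n} x w S {lo} {hi} lo≤hi inside apart with S zero in S₀
... | false = subst (_≤ hi - lo) (sym (+-identityˡ _))
  (disjoint-intervals-length (x ∘ suc) (w ∘ suc) (S ∘ suc) lo≤hi (inside ∘ suc)
    (λ i j Si Sj i≢j → apart (suc i) (suc j) Si Sj (i≢j ∘ suc-injective)))
... | true  = begin
  w₀ + sumOver (S ∘ suc) (w ∘ suc)
    ≡⟨ cong (w₀ +_) (sumOver-split (S ∘ suc) leftOf₀ (w ∘ suc)) ⟩
  w₀ + (sumOver left (w ∘ suc) + sumOver right (w ∘ suc))
    ≤⟨ +-monoʳ-≤ w₀ (+-mono-≤ left-length right-length) ⟩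
  w₀ + ((x₀ - lo) + (hi - (x₀ + w₀)))
    ≡⟨ solve 4 (λ w₀ x₀ lo hi → w₀ :+ ((x₀ :- lo) :+ (hi :- (x₀ :+ w₀))) := hi :- lo)
         refl w₀ x₀ lo hi ⟩
  hi - lo ∎
  where
  open ≤-Reasoning
  x₀ w₀ : ℚ
  x₀ = x zero
  w₀ = w zero
  S-zero : T (S zero)
  S-zero = subst T (sym S₀) tt
  leftOf₀ left right : Fin n → Bool
  leftOf₀ j = ⌊ x (suc j) + w (suc j) ≤? x₀ ⌋
  left  j = S (suc j) ∧ leftOf₀ j
  right j = S (suc j) ∧ not (leftOf₀ j)
  apart-suc : ∀ {P : Fin n → Bool} → P ⊆ (S ∘ suc) →
    ∀ i j → T (P i) → T (P j) → i ≢ j → Apart (x (suc i)) (w (suc i)) (x (suc j)) (w (suc j))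
  apart-suc P⊆S i j Pi Pj i≢j = apart (suc i) (suc j) (P⊆S i Pi) (P⊆S j Pj) (i≢j ∘ suc-injective)
  left⊆S : left ⊆ (S ∘ suc)
  left⊆S j = proj₁ ∘ to (T-∧ {S (suc j)})
  right⊆S : right ⊆ (S ∘ suc)
  right⊆S j = proj₁ ∘ to (T-∧ {S (suc j)})
  left-length : sumOver left (w ∘ suc) ≤ x₀ - lo
  left-length = disjoint-intervals-length (x ∘ suc) (w ∘ suc) left (proj₁ (inside zero S-zero))
    (λ j Lj → proj₁ (inside (suc j) (left⊆S j Lj)) , toWitness (proj₂ (to (T-∧ {S (suc j)}) Lj)))
    (apart-suc left⊆S)
  right-inside : ∀ j → T (right j) → x₀ + w₀ ≤ x (suc j) × x (suc j) + w (suc j) ≤ hi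
  right-inside j Rj with to (T-∧ {S (suc j)}) Rj
  ... | Sj , ¬left with apart zero (suc j) S-zero Sj (λ ())
  ...   | inj₁ after  = after , proj₂ (inside (suc j) Sj)
  ...   | inj₂ before = contradiction before (toWitnessFalse ¬left)
  right-length : sumOver right (w ∘ suc) ≤ hi - (x₀ + w₀)
  right-length = disjoint-intervals-length (x ∘ suc) (w ∘ suc) right (proj₂ (inside zero S-zero))
    right-inside (apart-suc right⊆S)

record Packs {n} (a H : ℚ) (I : Fin n → Item) (K : Fin n → Bool) (pos : Placement n) : Set where
  constructor packed
  field
    inBox      : ∀ i → T (K i) → InBox a H I pos i
    nonOverlap : ∀ i j → T (K i) → T (K j) → i ≢ j → NonOverlap I pos i j

Packs-⊆ : ∀ {n a H I} {K K′ : Fin n → Bool} {pos} → K′ ⊆ K → Packs a H I K pos → Packs a H I K′ pos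
Packs-⊆ K′⊆K (packed inBox nonOverlap) =
  packed (λ i → inBox i ∘ K′⊆K i) (λ i j K′i K′j → nonOverlap i j (K′⊆K i K′i) (K′⊆K j K′j))

PacksAll⇒Packs : ∀ {n a H I pos} → PacksAll {n} a H I pos → Packs a H I (λ _ → true) pos
PacksAll⇒Packs (inBox , nonOverlap) = packed (λ i _ → inBox i) (λ i j _ _ → nonOverlap i j)

∉-∪-tabulate : ∀ {n} (D₁ D₂ : Fin n → Bool) {i} →
  i ∉ tabulate D₁ ∪ tabulate D₂ → T (not (D₁ i ∨ D₂ i))
∉-∪-tabulate {n} D₁ D₂ {i} i∉ = ¬T⇒T-not λ D₁∨D₂ →
  i∉ (x∈p∪q⁺ (Sum.map ∈-tabulate ∈-tabulate (to (T-∨ {D₁ i}) D₁∨D₂)))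
  where
  ∈-tabulate : ∀ {D : Fin n → Bool} → T (D i) → i ∈ tabulate D
  ∈-tabulate {D} Di = lookup⇒[]= i (tabulate D) (trans (lookup∘tabulate D i) (to T-≡ Di))

Packs⇒PacksExcept : ∀ {n a H I} (D₁ D₂ : Fin n → Bool) {pos} →
  Packs a H I (λ i → not (D₁ i ∨ D₂ i)) pos → PacksExcept a H I (tabulate D₁ ∪ tabulate D₂) pos
Packs⇒PacksExcept D₁ D₂ (packed inBox nonOverlap) =
  (λ i i∉ → inBox i (∉-∪-tabulate D₁ D₂ i∉)) ,
  (λ i j i∉ j∉ → nonOverlap i j (∉-∪-tabulate D₁ D₂ i∉) (∉-∪-tabulate D₁ D₂ j∉))

profitOf-tabulate : ∀ {n} (I : Fin n → Item) (D : Fin n → Bool) →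
  profitOf I (tabulate D) ≡ sumOver D (profit ∘ I)
profitOf-tabulate I D = sumFin-cong (λ i → cong (λ b → select b (profit (I i))) (lookup∘tabulate D i))

∣tabulate∣*μ : ∀ {n} (D : Fin n → Bool) μ → ℕtoℚ ∣ tabulate D ∣ * μ ≡ sumOver D (λ _ → μ)
∣tabulate∣*μ {zero}  D μ = *-zeroˡ μ
∣tabulate∣*μ {suc n} D μ with D zero
... | true  = begin
  ℕtoℚ (suc c) * μ                  ≡⟨ cong (_* μ) (ℕtoℚ-suc c) ⟩
  (1ℚ + ℕtoℚ c) * μ                 ≡⟨ solve 2 (λ c μ → (con 1ℚ :+ c) :* μ := μ :+ c :* μ)
                                          refl (ℕtoℚ c) μ ⟩
  μ + ℕtoℚ c * μ                    ≡⟨ cong (μ +_) (∣tabulate∣*μ (D ∘ suc) μ) ⟩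
  μ + sumOver (D ∘ suc) (λ _ → μ)   ∎
  where
  open ≡-Reasoning
  c : ℕ
  c = ∣ tabulate (D ∘ suc) ∣
... | false = trans (∣tabulate∣*μ (D ∘ suc) μ) (sym (+-identityˡ _))

-- Removing horizontal bands

-- One round of the profit bound in removeBands: c is the profit of the band removed in this round,
-- d the profit removed in the remaining k rounds, e ≤ c + d their total, and P, P′ the profit
-- present before and after the round.
profit-recurrence : ∀ k s {c d e P P′} →
  ℕtoℚ (suc k ℕ.+ suc s) * c ≤ P → ℕtoℚ (k ℕ.+ suc s) * d ≤ ℕtoℚ k * P′ → P′ + c ≤ P →
  e ≤ c + d → ℕtoℚ (suc k ℕ.+ suc s) * e ≤ ℕtoℚ (suc k) * P
profit-recurrence k s {c} {d} {e} {P} {P′} cheap later split e≤c+d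
  rewrite ℕtoℚ-suc (k ℕ.+ suc s) | ℕtoℚ-+ k (suc s) | ℕtoℚ-suc k =
  *-cancelˡ-≤-pos ν {{positive 0<ν}} (begin
    ν * (ν₁ * e)                       ≤⟨ *-monoˡ-≤′ ν 0≤ν (*-monoˡ-≤′ ν₁ 0≤ν₁ e≤c+d) ⟩
    ν * (ν₁ * (c + d))                 ≡⟨ expand ⟩
    ν₁ * (ν * c) + ν₁ * (ν * d)        ≤⟨ +-monoʳ-≤ (ν₁ * (ν * c)) (*-monoˡ-≤′ ν₁ 0≤ν₁ later′) ⟩
    ν₁ * (ν * c) + ν₁ * (κ * (P - c))  ≡⟨ regroup ⟩
    σ * (ν₁ * c) + ν₁ * (κ * P)        ≤⟨ +-monoˡ-≤ (ν₁ * (κ * P)) (*-monoˡ-≤′ σ 0≤σ cheap) ⟩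
    σ * P + ν₁ * (κ * P)               ≡⟨ factor ⟩
    ν * ((1ℚ + κ) * P)                 ∎)
  where
  open ≤-Reasoning
  κ σ ν ν₁ : ℚ
  κ  = ℕtoℚ k
  σ  = ℕtoℚ (suc s)
  ν  = κ + σ
  ν₁ = 1ℚ + ν
  0≤σ : 0ℚ ≤ σ
  0≤σ = ℕtoℚ-nonNeg (suc s)
  0<ν : 0ℚ < ν
  0<ν = +-mono-≤-< (ℕtoℚ-nonNeg k) (ℕtoℚ-pos s)
  0≤ν : 0ℚ ≤ ν
  0≤ν = <⇒≤ 0<ν
  0≤ν₁ : 0ℚ ≤ ν₁
  0≤ν₁ = +-mono-≤ (<⇒≤ (ℕtoℚ-pos 0)) 0≤ν
  later′ : ν * d ≤ κ * (P - c)
  later′ = ≤-trans later (*-monoˡ-≤′ κ (ℕtoℚ-nonNeg k) (p+q≤r⇒p≤r-q split))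
  expand : ν * (ν₁ * (c + d)) ≡ ν₁ * (ν * c) + ν₁ * (ν * d)
  expand = solve 4 (λ κ σ c d →
    (κ :+ σ) :* ((con 1ℚ :+ (κ :+ σ)) :* (c :+ d)) :=
    (con 1ℚ :+ (κ :+ σ)) :* ((κ :+ σ) :* c) :+ (con 1ℚ :+ (κ :+ σ)) :* ((κ :+ σ) :* d)) refl κ σ c d
  regroup : ν₁ * (ν * c) + ν₁ * (κ * (P - c)) ≡ σ * (ν₁ * c) + ν₁ * (κ * P)
  regroup = solve 4 (λ κ σ c P →
    (con 1ℚ :+ (κ :+ σ)) :* ((κ :+ σ) :* c) :+ (con 1ℚ :+ (κ :+ σ)) :* (κ :* (P :- c)) :=
    σ :* ((con 1ℚ :+ (κ :+ σ)) :* c) :+ (con 1ℚ :+ (κ :+ σ)) :* (κ :* P)) refl κ σ c P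
  factor : σ * P + ν₁ * (κ * P) ≡ ν * ((1ℚ + κ) * P)
  factor = solve 3 (λ κ σ P →
    σ :* P :+ (con 1ℚ :+ (κ :+ σ)) :* (κ :* P) := (κ :+ σ) :* ((con 1ℚ :+ κ) :* P)) refl κ σ P

module Bands {n : ℕ} (I : Fin n → Item) (a β : ℚ) (0<β : 0ℚ < β)
             (0≤height : ∀ i → 0ℚ ≤ height (I i)) where

  level : ℕ → ℚ
  level j = ℕtoℚ j * β

  level-suc : ∀ j → level (suc j) ≡ level j + β
  level-suc j = trans (cong (_* β) (ℕtoℚ-suc j))
    (solve 2 (λ k b → (con 1ℚ :+ k) :* b := k :* b :+ b) refl (ℕtoℚ j) β)

  level-mono : ∀ {j k} → j ℕ.≤ k → level j ≤ level k
  level-mono j≤k = *-monoʳ-≤-nonNeg β {{nonNegative (<⇒≤ 0<β)}} (ℕtoℚ-mono j≤k)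

  level-nonNeg : ∀ j → 0ℚ ≤ level j
  level-nonNeg j = subst (_≤ level j) (*-zeroˡ β) (level-mono {0} {j} ℕ.z≤n)

  level-<-suc : ∀ j → level j < level (suc j)
  level-<-suc j = subst (level j <_) (sym (level-suc j))
    (subst (_< level j + β) (+-identityʳ (level j)) (+-monoʳ-< (level j) 0<β))

  level-<⇒≤ : ∀ {j k} → level j < level (suc k) → j ℕ.≤ k
  level-<⇒≤ lj<lk = ℕₚ.≮⇒≥ (λ k<j → <⇒≱ lj<lk (level-mono k<j))

  bottom top : Placement n → Fin n → ℚ
  bottom pos i = proj₂ (pos i)
  top    pos i = bottom pos i + height (I i)

  bottom≤top : ∀ pos i → bottom pos i ≤ top pos i
  bottom≤top pos i = p≤p+q (0≤height i)

  inBand crosses : ℕ → Placement n → Fin n → Bool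
  inBand  j pos i = ⌊ level j ≤? bottom pos i ⌋ ∧ ⌊ bottom pos i <? level (suc j) ⌋
  crosses j pos i = ⌊ bottom pos i <? level j ⌋ ∧ ⌊ level j <? top pos i ⌋

  survivors : ℕ → Placement n → (Fin n → Bool) → Fin n → Bool
  survivors j pos K i = K i ∧ not (inBand j pos i ∨ crosses j pos i)

  lowerAbove : ℕ → Placement n → Placement n
  lowerAbove j pos i =
    proj₁ (pos i) , (if ⌊ level (suc j) ≤? bottom pos i ⌋ then bottom pos i - β else bottom pos i)

  data Side (j : ℕ) (pos : Placement n) (i : Fin n) : Set where
    below : top pos i ≤ level j → Side j pos i
    above : level (suc j) ≤ bottom pos i → Side j pos i

  inBand-intro : ∀ j pos i → level j ≤ bottom pos i → bottom pos i < level (suc j) →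
    T (inBand j pos i)
  inBand-intro j pos i lj≤b b<lsj =
    from (T-∧ {⌊ level j ≤? bottom pos i ⌋})
      ( fromWitness {a? = level j ≤? bottom pos i} lj≤b
      , fromWitness {a? = bottom pos i <? level (suc j)} b<lsj)

  crosses-intro : ∀ j pos i → bottom pos i < level j → level j < top pos i → T (crosses j pos i)
  crosses-intro j pos i b<lj lj<t =
    from (T-∧ {⌊ bottom pos i <? level j ⌋})
      ( fromWitness {a? = bottom pos i <? level j} b<lj
      , fromWitness {a? = level j <? top pos i} lj<t)

  survivor-kept : ∀ {j pos K i} → T (survivors j pos K i) → T (K i)
  survivor-kept {j} {pos} {K} {i} = proj₁ ∘ to (T-∧ {K i} {not (inBand j pos i ∨ crosses j pos i)})

  survivor-not-removed : ∀ {j pos K i} → T (survivors j pos K i) →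
    ¬ T (inBand j pos i ∨ crosses j pos i)
  survivor-not-removed {j} {pos} {K} {i} = T-not⇒¬T {inBand j pos i ∨ crosses j pos i} ∘
    proj₂ ∘ to (T-∧ {K i} {not (inBand j pos i ∨ crosses j pos i)})

  survivor-side : ∀ {j pos K i} → T (survivors j pos K i) → Side j pos i
  survivor-side {j} {pos} {K} {i} Si = side (toSum (level j ≤? bottom pos i))
    where
    not-removed : ¬ T (inBand j pos i ∨ crosses j pos i)
    not-removed = survivor-not-removed {j} {pos} {K} {i} Si
    removed : T (inBand j pos i) ⊎ T (crosses j pos i) → T (inBand j pos i ∨ crosses j pos i)
    removed = from (T-∨ {inBand j pos i} {crosses j pos i})
    side : level j ≤ bottom pos i ⊎ ¬ level j ≤ bottom pos i → Side j pos i
    side (inj₁ lj≤b) = above (≮⇒≥ λ b<lsj →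
      not-removed (removed (inj₁ (inBand-intro j pos i lj≤b b<lsj))))
    side (inj₂ lj≰b) = below (≮⇒≥ λ lj<t →
      not-removed (removed (inj₂ (crosses-intro j pos i (≰⇒> lj≰b) lj<t))))

  lowered-above : ∀ j pos i → level (suc j) ≤ bottom pos i →
    bottom (lowerAbove j pos) i ≡ bottom pos i - β
  lowered-above j pos i lsj≤b =
    cong (λ b → if b then bottom pos i - β else bottom pos i) (to T-≡ (fromWitness lsj≤b))

  lowered-below : ∀ j pos i → top pos i ≤ level j → bottom (lowerAbove j pos) i ≡ bottom pos i
  lowered-below j pos i t≤lj =
    cong (λ b → if b then bottom pos i - β else bottom pos i) (to T-not-≡ (fromWitnessFalse b≱lsj))
    where
    b≱lsj : ¬ level (suc j) ≤ bottom pos i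
    b≱lsj = <⇒≱ (≤-<-trans (≤-trans (bottom≤top pos i) t≤lj) (level-<-suc j))

  lowered-inBox : ∀ {m j pos i} → j ℕ.≤ m → Side j pos i →
    InBox a (level (suc m)) I pos i → InBox a (level m) I (lowerAbove j pos) i
  lowered-inBox {m} {j} {pos} {i} j≤m (below t≤lj) (0≤x , x+w≤a , 0≤b , _) =
    0≤x , x+w≤a , subst (0ℚ ≤_) (sym lowered) 0≤b ,
    subst (λ y → y + height (I i) ≤ level m) (sym lowered) (≤-trans t≤lj (level-mono j≤m))
    where
    lowered : bottom (lowerAbove j pos) i ≡ bottom pos i
    lowered = lowered-below j pos i t≤lj
  lowered-inBox {m} {j} {pos} {i} j≤m (above lsj≤b) (0≤x , x+w≤a , _ , t≤H) =
    0≤x , x+w≤a , subst (0ℚ ≤_) (sym lowered) 0≤b-β ,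
    subst (λ y → y + height (I i) ≤ level m) (sym lowered) t-β≤lm
    where
    lowered : bottom (lowerAbove j pos) i ≡ bottom pos i - β
    lowered = lowered-above j pos i lsj≤b
    0≤b-β : 0ℚ ≤ bottom pos i - β
    0≤b-β = ≤-trans (level-nonNeg j) (p+q≤r⇒p≤r-q (subst (_≤ bottom pos i) (level-suc j) lsj≤b))
    t-β≤lm : (bottom pos i - β) + height (I i) ≤ level m
    t-β≤lm = subst (_≤ level m) (sym (p-r+q≡p+q-r (bottom pos i) (height (I i)) β))
      (p≤q+r⇒p-r≤q (subst (top pos i ≤_) (level-suc m) t≤H))

  lowered-separation : ∀ {j pos i k} → Side j pos i → Side j pos k → top pos i ≤ bottom pos k →
    top (lowerAbove j pos) i ≤ bottom (lowerAbove j pos) k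
  lowered-separation {j} {pos} {i} {k} (below ti≤lj) (below tk≤lj) ti≤bk =
    subst₂ (λ yi yk → yi + height (I i) ≤ yk)
      (sym (lowered-below j pos i ti≤lj)) (sym (lowered-below j pos k tk≤lj)) ti≤bk
  lowered-separation {j} {pos} {i} {k} (below ti≤lj) (above lsj≤bk) ti≤bk =
    subst₂ (λ yi yk → yi + height (I i) ≤ yk)
      (sym (lowered-below j pos i ti≤lj)) (sym (lowered-above j pos k lsj≤bk))
      (≤-trans ti≤lj (p+q≤r⇒p≤r-q (subst (_≤ bottom pos k) (level-suc j) lsj≤bk)))
  lowered-separation {j} {pos} {i} {k} (above lsj≤bi) (below tk≤lj) ti≤bk =
    contradiction (≤-<-trans lsj≤tk (≤-<-trans tk≤lj (level-<-suc j))) (<-irrefl refl)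
    where
    lsj≤tk : level (suc j) ≤ top pos k
    lsj≤tk = ≤-trans lsj≤bi (≤-trans (bottom≤top pos i) (≤-trans ti≤bk (bottom≤top pos k)))
  lowered-separation {j} {pos} {i} {k} (above lsj≤bi) (above lsj≤bk) ti≤bk =
    subst₂ (λ yi yk → yi + height (I i) ≤ yk)
      (sym (lowered-above j pos i lsj≤bi)) (sym (lowered-above j pos k lsj≤bk))
      (subst (_≤ bottom pos k - β) (sym (p-r+q≡p+q-r (bottom pos i) (height (I i)) β))
        (+-monoˡ-≤ (- β) ti≤bk))

  removeBand : ∀ {m j K pos} → j ℕ.≤ m → Packs a (level (suc m)) I K pos →
    Packs a (level m) I (survivors j pos K) (lowerAbove j pos)
  removeBand {m} {j} {K} {pos} j≤m (packed inBox nonOverlap) = packed inBox′ nonOverlap′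
    where
    side : ∀ {i} → T (survivors j pos K i) → Side j pos i
    side {i} = survivor-side {j} {pos} {K} {i}
    kept : ∀ {i} → T (survivors j pos K i) → T (K i)
    kept {i} = survivor-kept {j} {pos} {K} {i}
    inBox′ : ∀ i → T (survivors j pos K i) → InBox a (level m) I (lowerAbove j pos) i
    inBox′ i Si = lowered-inBox {m} {j} {pos} {i} j≤m (side Si) (inBox i (kept Si))
    nonOverlap′ : ∀ i k → T (survivors j pos K i) → T (survivors j pos K k) → i ≢ k →
      NonOverlap I (lowerAbove j pos) i k
    nonOverlap′ i k Si Sk i≢k = lowered (nonOverlap i k (kept Si) (kept Sk) i≢k)
      where
      lowered : NonOverlap I pos i k → NonOverlap I (lowerAbove j pos) i k
      lowered (inj₁ i-left-of-k)        = inj₁ i-left-of-k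
      lowered (inj₂ (inj₁ k-left-of-i)) = inj₂ (inj₁ k-left-of-i)
      lowered (inj₂ (inj₂ (inj₁ i-under-k))) =
        inj₂ (inj₂ (inj₁ (lowered-separation {j} {pos} {i} {k} (side Si) (side Sk) i-under-k)))
      lowered (inj₂ (inj₂ (inj₂ k-under-i))) =
        inj₂ (inj₂ (inj₂ (lowered-separation {j} {pos} {k} {i} (side Sk) (side Si) k-under-i)))

  crossing-apart : ∀ {j pos i k} → bottom pos i < level j → level j < top pos i →
    bottom pos k < level j → level j < top pos k →
    NonOverlap I pos i k → Apart (proj₁ (pos i)) (width (I i)) (proj₁ (pos k)) (width (I k))
  crossing-apart bi<lj lj<ti bk<lj lj<tk (inj₁ i-left-of-k)        = inj₁ i-left-of-k
  crossing-apart bi<lj lj<ti bk<lj lj<tk (inj₂ (inj₁ k-left-of-i)) = inj₂ k-left-of-i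
  crossing-apart bi<lj lj<ti bk<lj lj<tk (inj₂ (inj₂ (inj₁ ti≤bk))) =
    contradiction (<-trans lj<ti (≤-<-trans ti≤bk bk<lj)) (<-irrefl refl)
  crossing-apart bi<lj lj<ti bk<lj lj<tk (inj₂ (inj₂ (inj₂ tk≤bi))) =
    contradiction (<-trans lj<tk (≤-<-trans tk≤bi bi<lj)) (<-irrefl refl)

  crossing-count : ∀ {μ H K pos} j → 0ℚ ≤ a → (∀ i → μ ≤ width (I i)) → Packs a H I K pos →
    sumOver (λ i → K i ∧ crosses j pos i) (λ _ → μ) ≤ a
  crossing-count {μ} {H} {K} {pos} j 0≤a μ≤width (packed inBox nonOverlap) = begin
    sumOver X (λ _ → μ)    ≤⟨ sumOver-mono X (λ i _ → μ≤width i) ⟩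
    sumOver X (width ∘ I)  ≤⟨ disjoint-intervals-length (proj₁ ∘ pos) (width ∘ I) X 0≤a inside apart ⟩
    a - 0ℚ                 ≡⟨ +-identityʳ a ⟩
    a                      ∎
    where
    open ≤-Reasoning
    X : Fin n → Bool
    X i = K i ∧ crosses j pos i
    crossing : ∀ {i} → T (X i) → T (K i) × bottom pos i < level j × level j < top pos i
    crossing {i} Xi =
      let (Ki , Ci) = to (T-∧ {K i} {crosses j pos i}) Xi
          (b<lj , lj<t) = to (T-∧ {⌊ bottom pos i <? level j ⌋} {⌊ level j <? top pos i ⌋}) Ci
      in Ki , toWitness {a? = bottom pos i <? level j} b<lj ,
         toWitness {a? = level j <? top pos i} lj<t
    inside : ∀ i → T (X i) → 0ℚ ≤ proj₁ (pos i) × proj₁ (pos i) + width (I i) ≤ a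
    inside i Xi = let (0≤x , x+w≤a , _) = inBox i (proj₁ (crossing {i} Xi)) in 0≤x , x+w≤a
    apart : ∀ i k → T (X i) → T (X k) → i ≢ k →
      Apart (proj₁ (pos i)) (width (I i)) (proj₁ (pos k)) (width (I k))
    apart i k Xi Xk i≢k =
      let (Ki , bi<lj , lj<ti) = crossing {i} Xi
          (Kk , bk<lj , lj<tk) = crossing {k} Xk
      in crossing-apart {j} {pos} {i} {k} bi<lj lj<ti bk<lj lj<tk (nonOverlap i k Ki Kk i≢k)

  inBand-unique : ∀ {j k pos i} → T (inBand j pos i) → T (inBand k pos i) → j ≡ k
  inBand-unique {j} {k} {pos} {i} Bj Bk = ℕₚ.≤-antisym (lower Bj Bk) (lower Bk Bj)
    where
    lower : ∀ {j k} → T (inBand j pos i) → T (inBand k pos i) → j ℕ.≤ k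
    lower {j} {k} Bj Bk = level-<⇒≤ (≤-<-trans
      (toWitness {a? = level j ≤? bottom pos i}
        (proj₁ (to (T-∧ {⌊ level j ≤? bottom pos i ⌋} {⌊ bottom pos i <? level (suc j) ⌋}) Bj)))
      (toWitness {a? = bottom pos i <? level (suc k)}
        (proj₂ (to (T-∧ {⌊ level k ≤? bottom pos i ⌋} {⌊ bottom pos i <? level (suc k) ⌋}) Bk))))

  bands-cover : ∀ m K pos {f} → (∀ i → 0ℚ ≤ f i) →
    sumFin {suc m} (λ J → sumOver (λ i → K i ∧ inBand (toℕ J) pos i) f) ≤ sumOver K f
  bands-cover m K pos {f} 0≤f = ≤-trans
    (≤-reflexive (sumFin-comm {n} {suc m} (λ i J → select (K i ∧ inBand (toℕ J) pos i) (f i))))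
    (sumFin-mono (λ i → bands-of i (K i)))
    where
    bands-of : ∀ i k → sumFin {suc m} (λ J → select (k ∧ inBand (toℕ J) pos i) (f i)) ≤ select k (f i)
    bands-of i true  = sumOver-atMostOne {suc m} (λ J → inBand (toℕ J) pos i) {f i} (0≤f i)
      (λ J J′ BJ BJ′ → toℕ-injective {i = J} {J′} (inBand-unique {toℕ J} {toℕ J′} {pos} {i} BJ BJ′))
    bands-of i false = ≤-reflexive (sumFin-zero (suc m))

  cheapest-band : ∀ m K pos {f} → (∀ i → 0ℚ ≤ f i) →
    ∃[ j ] j ℕ.≤ m × ℕtoℚ (suc m) * sumOver (λ i → K i ∧ inBand j pos i) f ≤ sumOver K f
  cheapest-band m K pos {f} 0≤f =
    let (J , below-avg) = below-average m (λ J → sumOver (λ i → K i ∧ inBand (toℕ J) pos i) f)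
    in toℕ J , toℕ≤pred[n] J , ≤-trans below-avg (bands-cover m K pos 0≤f)

  survivors-profit : ∀ j pos K {f} → (∀ i → 0ℚ ≤ f i) →
    sumOver (survivors j pos K) f + sumOver (λ i → K i ∧ inBand j pos i) f ≤ sumOver K f
  survivors-profit j pos K {f} 0≤f = begin
    sumOver (survivors j pos K) f + inside-band
      ≤⟨ +-monoˡ-≤ inside-band
           (sumOver-⊆ {S = survivors j pos K} {outside-band} 0≤f survivor⇒outside-band) ⟩
    sumOver outside-band f + inside-band
      ≡⟨ +-comm (sumOver outside-band f) inside-band ⟩
    inside-band + sumOver outside-band f
      ≡⟨ sumOver-split K (λ i → inBand j pos i) f ⟨
    sumOver K f ∎
    where
    open ≤-Reasoning
    inside-band : ℚ
    inside-band = sumOver (λ i → K i ∧ inBand j pos i) f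
    outside-band : Fin n → Bool
    outside-band i = K i ∧ not (inBand j pos i)
    survivor⇒outside-band : survivors j pos K ⊆ outside-band
    survivor⇒outside-band i = boolean (K i) (inBand j pos i) (crosses j pos i)
      where
      boolean : ∀ k b c → T (k ∧ not (b ∨ c)) → T (k ∧ not b)
      boolean true false c _ = tt

  module _ {μ : ℚ} (0≤μ : 0ℚ ≤ μ) (μ≤width : ∀ i → μ ≤ width (I i)) (0≤a : 0ℚ ≤ a)
           (0≤profit : ∀ i → 0ℚ ≤ profit (I i)) where

    -- The profit bound keeps the exact ratio k/(k + s + 1): bounding each round only by its share
    -- of the current profit would give a harmonic sum instead of p/q.
    Removal : ℕ → ℕ → (Fin n → Bool) → Set
    Removal k s K = Σ[ D₁ ∈ (Fin n → Bool) ] Σ[ D₂ ∈ (Fin n → Bool) ] Σ[ pos′ ∈ Placement n ]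
      Packs a (level (suc s)) I (λ i → K i ∧ not (D₁ i ∨ D₂ i)) pos′ ×
      sumOver D₂ (λ _ → μ) ≤ ℕtoℚ k * a ×
      ℕtoℚ (k ℕ.+ suc s) * sumOver (λ i → K i ∧ D₁ i) (profit ∘ I) ≤ ℕtoℚ k * sumOver K (profit ∘ I)

    nothing-removed : ∀ s K pos → Packs a (level (suc s)) I K pos → Removal 0 s K
    nothing-removed s K pos packs =
      (λ _ → false) , (λ _ → false) , pos , Packs-⊆ (λ i → proj₁ ∘ to (T-∧ {K i} {true})) packs ,
      ≤-reflexive (trans (sumFin-zero n) (sym (*-zeroˡ a))) , ≤-reflexive no-profit
      where
      open ≡-Reasoning
      no-profit : ℕtoℚ (suc s) * sumOver (λ i → K i ∧ false) (profit ∘ I) ≡ 0ℚ * sumOver K (profit ∘ I)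
      no-profit = begin
        ℕtoℚ (suc s) * sumOver (λ i → K i ∧ false) (profit ∘ I)
          ≡⟨ cong (ℕtoℚ (suc s) *_)
               (sumFin-cong (λ i → cong (λ b → select b (profit (I i))) (∧-zeroʳ (K i)))) ⟩
        ℕtoℚ (suc s) * sumFin {n} (λ _ → 0ℚ)   ≡⟨ cong (ℕtoℚ (suc s) *_) (sumFin-zero n) ⟩
        ℕtoℚ (suc s) * 0ℚ                      ≡⟨ *-zeroʳ (ℕtoℚ (suc s)) ⟩
        0ℚ                                     ≡⟨ *-zeroˡ (sumOver K (profit ∘ I)) ⟨
        0ℚ * sumOver K (profit ∘ I)            ∎

    removeBand-step : ∀ k s K pos j → j ℕ.≤ k ℕ.+ suc s →
      ℕtoℚ (suc k ℕ.+ suc s) * sumOver (λ i → K i ∧ inBand j pos i) (profit ∘ I) ≤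
        sumOver K (profit ∘ I) →
      Packs a (level (suc k ℕ.+ suc s)) I K pos →
      Removal k s (survivors j pos K) → Removal (suc k) s K
    removeBand-step k s K pos j j≤m cheap packs (D₁′ , D₂′ , pos′ , packs′ , count′ , profit′) =
      D₁ , D₂ , pos′ , Packs-⊆ still-kept packs′ ,
      count , profit-bound
      where
      D₁ D₂ : Fin n → Bool
      D₁ i = (K i ∧ inBand j pos i) ∨ (survivors j pos K i ∧ D₁′ i)
      D₂ i = (K i ∧ crosses j pos i) ∨ D₂′ i
      still-kept : (λ i → K i ∧ not (D₁ i ∨ D₂ i)) ⊆ (λ i → survivors j pos K i ∧ not (D₁′ i ∨ D₂′ i))
      still-kept i = boolean (K i) (inBand j pos i) (crosses j pos i) (D₁′ i) (D₂′ i)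
        where
        boolean : ∀ k b c d₁ d₂ →
          T (k ∧ not (((k ∧ b) ∨ ((k ∧ not (b ∨ c)) ∧ d₁)) ∨ ((k ∧ c) ∨ d₂))) →
          T ((k ∧ not (b ∨ c)) ∧ not (d₁ ∨ d₂))
        boolean true false false false false _ = tt
      count : sumOver D₂ (λ _ → μ) ≤ ℕtoℚ (suc k) * a
      count = begin
        sumOver D₂ (λ _ → μ)
          ≤⟨ sumOver-∨ (λ i → K i ∧ crosses j pos i) D₂′ (λ _ → 0≤μ) ⟩
        sumOver (λ i → K i ∧ crosses j pos i) (λ _ → μ) + sumOver D₂′ (λ _ → μ)
          ≤⟨ +-mono-≤ (crossing-count {μ} {K = K} {pos} j 0≤a μ≤width packs) count′ ⟩
        a + ℕtoℚ k * a
          ≡⟨ solve 2 (λ a k → a :+ k :* a := (con 1ℚ :+ k) :* a) refl a (ℕtoℚ k) ⟩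
        (1ℚ + ℕtoℚ k) * a
          ≡⟨ cong (_* a) (ℕtoℚ-suc k) ⟨
        ℕtoℚ (suc k) * a ∎
        where open ≤-Reasoning
      removed-profit : sumOver (λ i → K i ∧ D₁ i) (profit ∘ I) ≤
        sumOver (λ i → K i ∧ inBand j pos i) (profit ∘ I) +
        sumOver (λ i → survivors j pos K i ∧ D₁′ i) (profit ∘ I)
      removed-profit = ≤-trans
        (sumOver-⊆ {S = λ i → K i ∧ D₁ i} {D₁} 0≤profit (λ i → proj₂ ∘ to (T-∧ {K i} {D₁ i})))
        (sumOver-∨ (λ i → K i ∧ inBand j pos i) (λ i → survivors j pos K i ∧ D₁′ i) 0≤profit)
      profit-bound : ℕtoℚ (suc k ℕ.+ suc s) * sumOver (λ i → K i ∧ D₁ i) (profit ∘ I) ≤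
        ℕtoℚ (suc k) * sumOver K (profit ∘ I)
      profit-bound = profit-recurrence k s cheap profit′ (survivors-profit j pos K 0≤profit) removed-profit

    removeBands : ∀ k s K pos → Packs a (level (k ℕ.+ suc s)) I K pos → Removal k s K
    removeBands zero    s K pos packs = nothing-removed s K pos packs
    removeBands (suc k) s K pos packs =
      let (j , j≤m , cheap) = cheapest-band (k ℕ.+ suc s) K pos 0≤profit
      in removeBand-step k s K pos j j≤m cheap packs
           (removeBands k s (survivors j pos K) (lowerAbove j pos) (removeBand {K = K} {pos} j≤m packs))

shrink-packing : ∀ p o {n μ a β} → 0ℚ ≤ μ → 0ℚ ≤ a → 0ℚ < β → (I : Fin n → Item) →
  (∀ i → WellFormed (I i)) → (∀ i → μ ≤ width (I i)) →
  (pos : Placement n) → PacksAll a (ℕtoℚ (p ℕ.+ suc o) * β) I pos →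
  ∃[ D₁ ] ∃[ D₂ ] ∃[ pos′ ]
    (ℕtoℚ (p ℕ.+ suc o) * profitOf I D₁ ≤ ℕtoℚ p * totalProfit I) ×
    (ℕtoℚ ∣ D₂ ∣ * μ ≤ ℕtoℚ p * a) ×
    PacksExcept a (ℕtoℚ (suc o) * β) I (D₁ ∪ D₂) pos′
shrink-packing p o {μ = μ} {a} {β} 0≤μ 0≤a 0<β I wf μ≤width pos packs =
  let (D₁ , D₂ , pos′ , packs′ , count , profit-bound) =
        removeBands 0≤μ μ≤width 0≤a (proj₂ ∘ proj₂ ∘ wf) p o (λ _ → true) pos (PacksAll⇒Packs packs)
  in tabulate D₁ , tabulate D₂ , pos′ ,
     subst (λ x → ℕtoℚ (p ℕ.+ suc o) * x ≤ ℕtoℚ p * totalProfit I)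
           (sym (profitOf-tabulate I D₁)) profit-bound ,
     subst (_≤ ℕtoℚ p * a) (sym (∣tabulate∣*μ D₂ μ)) count ,
     Packs⇒PacksExcept D₁ D₂ packs′
  where open Bands I a β 0<β (proj₁ ∘ proj₂ ∘ wf)

fraction-decomposition : ∀ ε → 0ℚ < ε → ε < 1ℚ → ∃[ p ] ∃[ o ] ℕtoℚ (p ℕ.+ suc o) * ε ≡ ℕtoℚ p
fraction-decomposition (mkℚ (ℤ.+ zero) _ _) (*<* 0<0) _ = contradiction 0<0 (ℤₚ.<-irrefl refl)
fraction-decomposition (mkℚ ℤ.-[1+ _ ] _ _) (*<* ()) _
fraction-decomposition (mkℚ (ℤ.+ suc p₀) d coprime) _ (*<* p<q) =
  let (o , p+1+o≡q) = ℕₚ.m≤n⇒∃[o]m+o≡n {suc (suc p₀)} {suc d} (ℤₚ.drop‿+<+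
        (subst₂ ℤ._<_ (ℤₚ.*-identityʳ (ℤ.+ suc p₀)) (ℤₚ.*-identityˡ (ℤ.+ suc d)) p<q))
  in suc p₀ , o ,
     trans (cong (λ q → ℕtoℚ q * mkℚ (ℤ.+ suc p₀) d coprime) (trans (ℕₚ.+-suc (suc p₀) o) p+1+o≡q))
           (ℕtoℚ-*-mkℚ (suc p₀) d coprime)

split-height : ∀ {Q b} → 0ℚ < Q → 0ℚ < b → ∃[ β ] 0ℚ < β × Q * β ≡ b
split-height {Q} {b} 0<Q 0<b = 1/ Q * b , positive⁻¹ (1/ Q * b) {{pos*pos⇒pos (1/ Q) b}} , Qβ≡b
  where
  instance
    Q-pos : Positive Q
    Q-pos = positive 0<Q
    Q≢0 : NonZero Q
    Q≢0 = pos⇒nonZero Q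
    1/Q-pos : Positive (1/ Q)
    1/Q-pos = 1/pos⇒pos Q
    b-pos : Positive b
    b-pos = positive 0<b
  Qβ≡b : Q * (1/ Q * b) ≡ b
  Qβ≡b = trans (sym (*-assoc Q (1/ Q) b)) (trans (cong (_* b) (*-inverseʳ Q)) (*-identityˡ b))

remaining-height : ∀ {Q P S ε β b} → Q ≡ P + S → Q * ε ≡ P → Q * β ≡ b → S * β ≡ (1ℚ - ε) * b
remaining-height {Q} {P} {S} {ε} {β} {b} Q≡P+S Qε≡P Qβ≡b = begin
  S * β                  ≡⟨ solve 3 (λ P S β → S :* β := (P :+ S) :* β :- P :* β) refl P S β ⟩
  (P + S) * β - P * β    ≡⟨ cong₂ (λ x y → x * β - y * β) Q≡P+S Qε≡P ⟨
  Q * β - (Q * ε) * β    ≡⟨ solve 3 (λ Q ε β → Q :* β :- (Q :* ε) :* β := (con 1ℚ :- ε) :* (Q :* β))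
                              refl Q ε β ⟩
  (1ℚ - ε) * (Q * β)     ≡⟨ cong ((1ℚ - ε) *_) Qβ≡b ⟩
  (1ℚ - ε) * b           ∎
  where open ≡-Reasoning

cancel-fraction : ∀ {Q ε P x y} → 0ℚ < Q → Q * ε ≡ P → Q * x ≤ P * y → x ≤ ε * y
cancel-fraction {Q} {ε} {P} {x} {y} 0<Q Qε≡P Qx≤Py = *-cancelˡ-≤-pos Q {{positive 0<Q}}
  (subst (Q * x ≤_) (trans (cong (_* y) (sym Qε≡P)) (*-assoc Q ε y)) Qx≤Py)

lemma6 : (εbox : ℚ) → 0ℚ < εbox → εbox < 1ℚ →
    ∃[ C ] (∀ (μ a b : ℚ) → 0ℚ < μ → 0ℚ < a → a ≤ 1ℚ → 0ℚ < b →
      ∀ (n : ℕ) (I : Fin n → Item) → (∀ i → WellFormed (I i)) →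
      (∀ i → μ ≤ width (I i)) →
      (pos : Placement n) → PacksAll a b I pos →
      ∃[ D₁ ] ∃[ D₂ ] ∃[ pos′ ]
        (profitOf I D₁ ≤ εbox * totalProfit I) ×
        (ℕtoℚ ∣ D₂ ∣ * μ ≤ ℕtoℚ C) ×
        PacksExcept a ((1ℚ - εbox) * b) I (D₁ ∪ D₂) pos′)
lemma6 ε 0<ε ε<1 =
  let (p , o , qε≡p) = fraction-decomposition ε 0<ε ε<1 in
  p , λ μ a b 0<μ 0<a a≤1 0<b n I wf μ≤width pos packs →
  let q : ℕ
      q = p ℕ.+ suc o
      0<q : 0ℚ < ℕtoℚ q
      0<q = <-≤-trans (ℕtoℚ-pos o) (ℕtoℚ-mono (ℕₚ.m≤n+m (suc o) p))
      (β , 0<β , qβ≡b) = split-height {ℕtoℚ q} {b} 0<q 0<b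
      (D₁ , D₂ , pos′ , profit-bound , count , packs′) =
        shrink-packing p o {n} {μ} {a} {β} (<⇒≤ 0<μ) (<⇒≤ 0<a) 0<β I wf μ≤width pos
          (subst (λ H → PacksAll a H I pos) (sym qβ≡b) packs)
  in D₁ , D₂ , pos′ ,
     cancel-fraction 0<q qε≡p profit-bound ,
     ≤-trans count (≤-trans (*-monoˡ-≤′ (ℕtoℚ p) (ℕtoℚ-nonNeg p) a≤1)
                            (≤-reflexive (*-identityʳ (ℕtoℚ p)))) ,
     subst (λ H → PacksExcept a H I (D₁ ∪ D₂) pos′)
           (remaining-height (ℕtoℚ-+ p (suc o)) qε≡p qβ≡b) packs′
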